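{- Let $M$ be a matroid of rank $r$ on a finite set $E$ with rank function $\mathrm{rk}$. Let $\underline{x}=\{x_e: e\in E\}$ and $\underline{y}=\{y_e:e\in E\}$ be families of commuting indeterminates indexed by $E$, and let $\lambda,\xi$ be further indeterminates. Then $$ \mathbf{SC} (M; \underline{xy}, \lambda \xi) = \sum_{T:\, T \subseteq E} \lambda^{r - \mathrm{rk} (T)} \underline{(-y)}^{T}\, \mathbf{SC} (M|T;\underline{ -x},\lambda)\, \mathbf{SC} (M/T;\underline{y},\xi). $$
   Context: For a matroid $N$ of rank $s$ on a set $F$ with rank function $\mathrm{rk}_N$ and a family $\underline{z}=\{z_e:e\in F\}$, the subset-corank polynomial is $\mathbf{SC}(N;\underline{z},\lambda)=\sum_{A\subseteq F}\underline{z}^A\lambda^{s-\mathrm{rk}_N(A)}$, where $\underline{z}^A=\prod_{e\in A}z_e$. Notation: $\underline{ -x}=\{ -x_e\}$, $\underline{xy}=\{x_ey_e\}$, $\underline{(-y)}^T=\prod_{e\in T}(-y_e)$; families are restricted to the ground set of the matroid in question. $M|T$ is the restriction of $M$ to $T$ (rank $\mathrm{rk}(T)$, rank function $\mathrm{rk}$ restricted to subsets of $T$), and $M/T$ is the contraction, a matroid on $E\setminus T$ of rank $r-\mathrm{rk}(T)$ with rank function $A\mapsto \mathrm{rk}(A\cup T)-\mathrm{rk}(T)$. -}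

module Defs where

open import Level using (Level)
open import Data.Nat as ℕ using (ℕ; zero; suc; _∸_)
open import Data.Bool using (Bool; true; false; if_then_else_)
open import Data.Vec using (Vec; []; _∷_)
open import Data.List using (List; []; _∷_; _++_; map; foldr)
open import Data.Fin as Fin using (Fin; zero; suc)
open import Data.Fin.Subset using (Subset; _⊆_; _∪_; _∩_; ∁; ⊤; ∣_∣)
open import Algebra.Bundles using (CommutativeRing)

record IsMatroidRank (n : ℕ) (rk : Subset n → ℕ) : Set where
  field
    rk-≤-card  : ∀ A → rk A ℕ.≤ ∣ A ∣
    rk-mono    : ∀ {A B} → A ⊆ B → rk A ℕ.≤ rk B
    rk-submod  : ∀ A B → rk (A ∪ B) ℕ.+ rk (A ∩ B) ℕ.≤ rk A ℕ.+ rk B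

record Matroid (n : ℕ) : Set where
  field
    rk      : Subset n → ℕ
    isRank  : IsMatroidRank n rk

rankM : ∀ {n} → Matroid n → ℕ
rankM M = Matroid.rk M ⊤

-- A "minor-like" matroid N living on a ground subset F ⊆ Fin n:
-- its ground set, its rank s, and its rank function (used on subsets of F).
record GroundedRank (n : ℕ) : Set where
  field
    ground : Subset n
    rank   : ℕ
    rkN    : Subset n → ℕ

asGR : ∀ {n} → Matroid n → GroundedRank n
asGR M = record { ground = ⊤ ; rank = rankM M ; rkN = Matroid.rk M }

restrict : ∀ {n} → Matroid n → Subset n → GroundedRank n
restrict M T = record { ground = T ; rank = Matroid.rk M T ; rkN = Matroid.rk M }

contract : ∀ {n} → Matroid n → Subset n → GroundedRank n
contract M T = record
  { ground = ∁ T
  ; rank   = rankM M ∸ Matroid.rk M T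
  ; rkN    = λ A → Matroid.rk M (A ∪ T) ∸ Matroid.rk M T }

subsetsOf : ∀ {n} → Subset n → List (Subset n)
subsetsOf {zero}  []          = [] ∷ []
subsetsOf {suc n} (true ∷ G)  = map (true ∷_) (subsetsOf G) ++ map (false ∷_) (subsetsOf G)
subsetsOf {suc n} (false ∷ G) = map (false ∷_) (subsetsOf G)

module RingOps {c ℓ : Level} (R : CommutativeRing c ℓ) where
  open CommutativeRing R using (Carrier; _+_; _*_; 0#; 1#)

  pow : Carrier → ℕ → Carrier
  pow a ℕ.zero  = 1#
  pow a (suc k) = a * pow a k

  sumL : List Carrier → Carrier
  sumL = foldr _+_ 0#

  monomial : ∀ {n} → (Fin n → Carrier) → Subset n → Carrier
  monomial {ℕ.zero} z []      = 1#
  monomial {suc n} z (b ∷ A) =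
    (if b then z Fin.zero else 1#) * monomial (λ i → z (suc i)) A

  SC : ∀ {n} → GroundedRank n → (Fin n → Carrier) → Carrier → Carrier
  SC N z l = sumL (map (λ A → monomial z A * pow l (GroundedRank.rank N ∸ GroundedRank.rkN N A))
                       (subsetsOf (GroundedRank.ground N)))

module Submission where

open import Defs
open import Level using (Level)
open import Data.Nat using (ℕ; _∸_)
open import Data.Fin using (Fin)
open import Data.Fin.Subset using (⊤)
open import Data.List using (map)
open import Algebra.Bundles using (CommutativeRing)

open import Data.Nat using (zero; suc)
import Data.Nat as ℕ
open import Data.Nat.Properties using (m∸n+n≡m; +-∸-assoc; ∸-+-assoc; m+[n∸m]≡n)
open import Data.Bool using (Bool; true; false; if_then_else_; _∨_)
open import Data.Vec using ([]; _∷_)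
open import Data.List using ([]; _∷_; _++_)
open import Data.List.Properties using (map-∘)
open import Data.List.Relation.Unary.All as All using (All; []; _∷_)
import Data.List.Relation.Unary.All.Properties as All
open import Data.Fin.Subset using (Subset; _⊆_; _∪_; ∁)
open import Data.Fin.Subset.Properties using (in⊆in; out⊆; ⊆⊤; q⊆p∪q)
open import Relation.Binary.PropositionalEquality as ≡ using (_≡_)

-- Put  g(B,U) = λ^{r - rk B} ξ^{r - rk U}.  Expanding both
-- SC-factors, the T-th summand on the right becomes
--   Σ_{B ⊆ T} Σ_{C ⊆ E∖T} (-y)^T (-x)^B y^C g(B, C ∪ T),
-- because the exponents telescope: (r - rk T) + (rk T - rk B) = r - rk B and
-- (r - rk T) - (rk (C∪T) - rk T) = r - rk (C∪T).  The left side is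
-- Σ_A (xy)^A g(A,A).  So the theorem is an instance of an identity that holds
-- for an arbitrary weight g : Subset n → Subset n → R (no matroid needed):
-- an inclusion–exclusion on the Boolean lattice.  We prove it by induction on
-- n, peeling off the first element of the ground set: a flag B ⊆ T, C ⊆ E∖T
-- puts the element into (B,T), (T only), (C only) or nowhere, with
-- coefficients (-y₀)(-x₀) = x₀y₀, -y₀, y₀ and 1; the two middle cases cancel,
-- leaving exactly the two cases of the diagonal sum.

∸-telescope : ∀ {r t b} → b ℕ.≤ t → t ℕ.≤ r → (r ∸ t) ℕ.+ (t ∸ b) ≡ r ∸ b
∸-telescope {r} {t} {b} b≤t t≤r = begin
  (r ∸ t) ℕ.+ (t ∸ b)  ≡⟨ +-∸-assoc (r ∸ t) b≤t ⟨
  (r ∸ t ℕ.+ t) ∸ b    ≡⟨ ≡.cong (_∸ b) (m∸n+n≡m t≤r) ⟩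
  r ∸ b                ∎
  where open ≡.≡-Reasoning

∸-∸-cancel : ∀ r {t u} → t ℕ.≤ u → (r ∸ t) ∸ (u ∸ t) ≡ r ∸ u
∸-∸-cancel r {t} {u} t≤u = ≡.trans (∸-+-assoc r t (u ∸ t)) (≡.cong (r ∸_) (m+[n∸m]≡n t≤u))

subsetsOf-⊆ : ∀ {n} (G : Subset n) → All (_⊆ G) (subsetsOf G)
subsetsOf-⊆ {zero}  []          = (λ A → A) ∷ []
subsetsOf-⊆ {suc n} (true ∷ G)  =
  All.++⁺ (All.map⁺ (All.map in⊆in (subsetsOf-⊆ G))) (All.map⁺ (All.map out⊆ (subsetsOf-⊆ G)))
subsetsOf-⊆ {suc n} (false ∷ G) = All.map⁺ (All.map out⊆ (subsetsOf-⊆ G))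

module Identities {c ℓ} (R : CommutativeRing c ℓ) where
  open CommutativeRing R hiding (zero)
  open RingOps R
  open import Algebra.Properties.Ring ring using (-‿distribˡ-*; -‿distribʳ-*; -‿involutive)
  open import Relation.Binary.Reasoning.Setoid setoid
  import Algebra.Solver.CommutativeMonoid *-commutativeMonoid as ×-Solver
  import Algebra.Solver.CommutativeMonoid +-commutativeMonoid as +-Solver

  module _ {a} {A : Set a} where
    sum-cong : ∀ {f h : A → Carrier} xs → (∀ x → f x ≈ h x) → sumL (map f xs) ≈ sumL (map h xs)
    sum-cong []       f≈h = refl
    sum-cong (x ∷ xs) f≈h = +-cong (f≈h x) (sum-cong xs f≈h)

    sum-cong-All : ∀ {P : A → Set} {f h : A → Carrier} {xs} →
                   All P xs → (∀ x → P x → f x ≈ h x) → sumL (map f xs) ≈ sumL (map h xs)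
    sum-cong-All []         f≈h = refl
    sum-cong-All (px ∷ pxs) f≈h = +-cong (f≈h _ px) (sum-cong-All pxs f≈h)

    sum-++ : ∀ (f : A → Carrier) xs ys → sumL (map f (xs ++ ys)) ≈ sumL (map f xs) + sumL (map f ys)
    sum-++ f []       ys = sym (+-identityˡ _)
    sum-++ f (x ∷ xs) ys = trans (+-congˡ (sum-++ f xs ys)) (sym (+-assoc _ _ _))

    sum-*ˡ : ∀ k (f : A → Carrier) xs → k * sumL (map f xs) ≈ sumL (map (λ a → k * f a) xs)
    sum-*ˡ k f []       = zeroʳ k
    sum-*ˡ k f (x ∷ xs) = trans (distribˡ k _ _) (+-congˡ (sum-*ˡ k f xs))

    sum-*ʳ : ∀ k (f : A → Carrier) xs → sumL (map f xs) * k ≈ sumL (map (λ a → f a * k) xs)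
    sum-*ʳ k f []       = zeroˡ k
    sum-*ʳ k f (x ∷ xs) = trans (distribʳ k _ _) (+-congˡ (sum-*ʳ k f xs))

    sum-+ : ∀ (f h : A → Carrier) xs → sumL (map (λ a → f a + h a) xs) ≈ sumL (map f xs) + sumL (map h xs)
    sum-+ f h []       = sym (+-identityˡ _)
    sum-+ f h (x ∷ xs) = trans (+-congˡ (sum-+ f h xs))
      (+-Solver.solve 4 (λ p q s t → (p ⊕ q) ⊕ (s ⊕ t) ⊜ (p ⊕ s) ⊕ (q ⊕ t))
                        refl (f x) (h x) (sumL (map f xs)) (sumL (map h xs)))
      where open +-Solver using (_⊕_; _⊜_)

    sum-scaled : ∀ {f h : A → Carrier} k xs → (∀ a → f a ≈ k * h a) →
                 sumL (map f xs) ≈ k * sumL (map h xs)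
    sum-scaled k xs f≈kh = trans (sum-cong xs f≈kh) (sym (sum-*ˡ k _ xs))

    sum-linear : ∀ {f h h′ : A → Carrier} k k′ xs → (∀ a → f a ≈ k * h a + k′ * h′ a) →
                 sumL (map f xs) ≈ k * sumL (map h xs) + k′ * sumL (map h′ xs)
    sum-linear k k′ xs f≈ =
      trans (sum-cong xs f≈) (trans (sum-+ _ _ xs) (+-cong (sym (sum-*ˡ k _ xs)) (sym (sum-*ˡ k′ _ xs))))

  sum-product : ∀ {a b} {A : Set a} {B : Set b} k (f : A → Carrier) (h : B → Carrier) xs ys →
                (k * sumL (map f xs)) * sumL (map h ys)
                ≈ sumL (map (λ a → sumL (map (λ b → (k * f a) * h b) ys)) xs)
  sum-product k f h xs ys =
    trans (*-congʳ (sum-*ˡ k f xs))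
    (trans (sum-*ʳ _ _ xs) (sum-cong xs (λ a → sum-*ˡ _ h ys)))

  sum-subsets-true : ∀ {n} (f : Subset (suc n) → Carrier) G →
                     sumL (map f (subsetsOf (true ∷ G)))
                     ≈ sumL (map (λ A → f (true ∷ A)) (subsetsOf G))
                       + sumL (map (λ A → f (false ∷ A)) (subsetsOf G))
  sum-subsets-true f G =
    trans (sum-++ f (map (true ∷_) (subsetsOf G)) (map (false ∷_) (subsetsOf G)))
          (+-cong (reflexive (≡.cong sumL (≡.sym (map-∘ (subsetsOf G)))))
                  (reflexive (≡.cong sumL (≡.sym (map-∘ (subsetsOf G))))))

  sum-subsets-false : ∀ {n} (f : Subset (suc n) → Carrier) G →
                      sumL (map f (subsetsOf (false ∷ G))) ≡ sumL (map (λ A → f (false ∷ A)) (subsetsOf G))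
  sum-subsets-false f G = ≡.cong sumL (≡.sym (map-∘ (subsetsOf G)))

  pow-+ : ∀ a m k → pow a m * pow a k ≈ pow a (m ℕ.+ k)
  pow-+ a zero    k = *-identityˡ _
  pow-+ a (suc m) k = trans (*-assoc _ _ _) (*-congˡ (pow-+ a m k))

  pow-* : ∀ a b k → pow (a * b) k ≈ pow a k * pow b k
  pow-* a b zero    = sym (*-identityˡ 1#)
  pow-* a b (suc k) = trans (*-congˡ (pow-* a b k))
    (×-Solver.solve 4 (λ a b p q → (a ⊕ b) ⊕ (p ⊕ q) ⊜ (a ⊕ p) ⊕ (b ⊕ q))
                      refl a b (pow a k) (pow b k))
    where open ×-Solver using (_⊕_; _⊜_)

  -- The weight  z  if the element is present,  1  otherwise: one factor of a
  -- monomial, since  monomial z (b ∷ A) = present b (z 0) * monomial (z ∘ suc) A.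
  present : Bool → Carrier → Carrier
  present b z = if b then z else 1#

  -- The two sides of the Boolean inversion identity, for an arbitrary weight g.
  -- A flag is a pair B ⊆ T together with C ⊆ E∖T; its term carries g(B, C ∪ T).
  module _ {n : ℕ} (x y : Fin n → Carrier) (g : Subset n → Subset n → Carrier) where
    flagTerm : Subset n → Subset n → Subset n → Carrier
    flagTerm T B C = monomial (λ e → - y e) T * monomial (λ e → - x e) B * monomial y C * g B (C ∪ T)

    complementSum : Subset n → Subset n → Carrier
    complementSum T B = sumL (map (flagTerm T B) (subsetsOf (∁ T)))

    flagSum : Subset n → Carrier
    flagSum T = sumL (map (complementSum T) (subsetsOf T))

    totalFlagSum : Carrier
    totalFlagSum = sumL (map flagSum (subsetsOf ⊤))

    diagonalSum : Carrier
    diagonalSum = sumL (map (λ A → monomial (λ e → x e * y e) A * g A A) (subsetsOf ⊤))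

  module Peel {n : ℕ} (x y : Fin (suc n) → Carrier) (g : Subset (suc n) → Subset (suc n) → Carrier) where
    x₀ y₀ : Carrier
    x₀ = x Fin.zero
    y₀ = y Fin.zero

    x′ y′ : Fin n → Carrier
    x′ i = x (Fin.suc i)
    y′ i = y (Fin.suc i)

    g[_,_] : Bool → Bool → Subset n → Subset n → Carrier
    g[ b , u ] B U = g (b ∷ B) (u ∷ U)

    coeff : Bool → Bool → Bool → Carrier
    coeff t b c = present t (- y₀) * present b (- x₀) * present c y₀

    flagTerm-peel : ∀ t b c T B C →
      flagTerm x y g (t ∷ T) (b ∷ B) (c ∷ C) ≈ coeff t b c * flagTerm x′ y′ g[ b , c ∨ t ] T B C
    flagTerm-peel t b c T B C =
      ×-Solver.solve 7 (λ pt pb pc mT mB mC w →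
          (((pt ⊕ mT) ⊕ (pb ⊕ mB)) ⊕ (pc ⊕ mC)) ⊕ w ⊜ ((pt ⊕ pb) ⊕ pc) ⊕ (((mT ⊕ mB) ⊕ mC) ⊕ w))
        refl (present t (- y₀)) (present b (- x₀)) (present c y₀)
             (monomial (λ e → - y′ e) T) (monomial (λ e → - x′ e) B) (monomial y′ C)
             (g[ b , c ∨ t ] B (C ∪ T))
      where open ×-Solver using (_⊕_; _⊜_)

    -- If the element is in T it cannot be in C.
    complementSum-in : ∀ b T B →
      complementSum x y g (true ∷ T) (b ∷ B) ≈ coeff true b false * complementSum x′ y′ g[ b , true ] T B
    complementSum-in b T B =
      trans (reflexive (sum-subsets-false (flagTerm x y g (true ∷ T) (b ∷ B)) (∁ T)))
            (sum-scaled _ (subsetsOf (∁ T)) (flagTerm-peel true b false T B))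

    -- If the element is outside T (hence outside B), it may or may not lie in C.
    complementSum-out : ∀ T B →
      complementSum x y g (false ∷ T) (false ∷ B)
      ≈ coeff false false true * complementSum x′ y′ g[ false , true ] T B
        + coeff false false false * complementSum x′ y′ g[ false , false ] T B
    complementSum-out T B =
      trans (sum-subsets-true (flagTerm x y g (false ∷ T) (false ∷ B)) (∁ T))
            (+-cong (sum-scaled _ (subsetsOf (∁ T)) (flagTerm-peel false false true T B))
                    (sum-scaled _ (subsetsOf (∁ T)) (flagTerm-peel false false false T B)))

    flagSum-in : ∀ T →
      flagSum x y g (true ∷ T)
      ≈ coeff true true false * flagSum x′ y′ g[ true , true ] T
        + coeff true false false * flagSum x′ y′ g[ false , true ] T
    flagSum-in T =
      trans (sum-subsets-true (complementSum x y g (true ∷ T)) T)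
            (+-cong (sum-scaled _ (subsetsOf T) (complementSum-in true T))
                    (sum-scaled _ (subsetsOf T) (complementSum-in false T)))

    flagSum-out : ∀ T →
      flagSum x y g (false ∷ T)
      ≈ coeff false false true * flagSum x′ y′ g[ false , true ] T
        + coeff false false false * flagSum x′ y′ g[ false , false ] T
    flagSum-out T =
      trans (reflexive (sum-subsets-false (complementSum x y g (false ∷ T)) T))
            (sum-linear _ _ (subsetsOf T) (complementSum-out T))

    totalFlagSum-peel :
      totalFlagSum x y g
      ≈ (coeff true true false * totalFlagSum x′ y′ g[ true , true ]
         + coeff true false false * totalFlagSum x′ y′ g[ false , true ])
        + (coeff false false true * totalFlagSum x′ y′ g[ false , true ]
           + coeff false false false * totalFlagSum x′ y′ g[ false , false ])
    totalFlagSum-peel =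
      trans (sum-subsets-true (flagSum x y g) ⊤)
            (+-cong (sum-linear _ _ (subsetsOf ⊤) flagSum-in)
                    (sum-linear _ _ (subsetsOf ⊤) flagSum-out))

    diagonalSum-peel :
      diagonalSum x y g ≈ (x₀ * y₀) * diagonalSum x′ y′ g[ true , true ] + 1# * diagonalSum x′ y′ g[ false , false ]
    diagonalSum-peel =
      trans (sum-subsets-true (λ A → monomial (λ e → x e * y e) A * g A A) (⊤ {n}))
            (+-cong (sum-scaled (x₀ * y₀) (subsetsOf (⊤ {n})) (λ A → *-assoc _ _ _))
                    (sum-scaled 1# (subsetsOf (⊤ {n})) (λ A → *-assoc _ _ _)))

    -- The coefficients: a flag containing the element in B and T contributes
    -- x₀y₀, one with it in T only cancels one with it in C only, and the
    -- empty case contributes 1.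
    coeff-in-B : coeff true true false ≈ x₀ * y₀
    coeff-in-B = begin
      (- y₀) * (- x₀) * 1#  ≈⟨ *-identityʳ _ ⟩
      (- y₀) * (- x₀)       ≈⟨ -‿distribˡ-* y₀ (- x₀) ⟨
      - (y₀ * (- x₀))       ≈⟨ -‿cong (-‿distribʳ-* y₀ x₀) ⟨
      - (- (y₀ * x₀))       ≈⟨ -‿involutive (y₀ * x₀) ⟩
      y₀ * x₀               ≈⟨ *-comm y₀ x₀ ⟩
      x₀ * y₀               ∎

    coeff-cancel : coeff true false false + coeff false false true ≈ 0#
    coeff-cancel = begin
      (- y₀) * 1# * 1# + 1# * 1# * y₀  ≈⟨ +-cong (trans (*-identityʳ _) (*-identityʳ _))
                                                  (trans (*-congʳ (*-identityˡ 1#)) (*-identityˡ y₀)) ⟩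
      (- y₀) + y₀                      ≈⟨ -‿inverseˡ y₀ ⟩
      0#                               ∎

    coeff-empty : coeff false false false ≈ 1#
    coeff-empty = trans (*-identityʳ _) (*-identityʳ _)

  cancel-middle : ∀ {a b c d p q s} → b + c ≈ 0# → (a * p + b * q) + (c * q + d * s) ≈ a * p + d * s
  cancel-middle {a} {b} {c} {d} {p} {q} {s} b+c≈0 = begin
    (a * p + b * q) + (c * q + d * s)  ≈⟨ +-Solver.solve 4 (λ u v w z → (u ⊕ v) ⊕ (w ⊕ z) ⊜ (u ⊕ z) ⊕ (v ⊕ w))
                                                          refl (a * p) (b * q) (c * q) (d * s) ⟩
    (a * p + d * s) + (b * q + c * q)  ≈⟨ +-congˡ (sym (distribʳ q b c)) ⟩
    (a * p + d * s) + (b + c) * q      ≈⟨ +-congˡ (trans (*-congʳ b+c≈0) (zeroˡ q)) ⟩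
    (a * p + d * s) + 0#               ≈⟨ +-identityʳ _ ⟩
    a * p + d * s                      ∎
    where open +-Solver using (_⊕_; _⊜_)

  totalFlagSum≈diagonalSum : ∀ n (x y : Fin n → Carrier) (g : Subset n → Subset n → Carrier) →
                        totalFlagSum x y g ≈ diagonalSum x y g
  totalFlagSum≈diagonalSum zero x y g = begin
    ((1# * 1# * 1# * g [] [] + 0#) + 0#) + 0#  ≈⟨ trans (+-identityʳ _) (trans (+-identityʳ _) (+-identityʳ _)) ⟩
    1# * 1# * 1# * g [] []                     ≈⟨ *-congʳ (trans (*-identityʳ _) (*-identityʳ _)) ⟩
    1# * g [] []                               ≈⟨ +-identityʳ _ ⟨
    1# * g [] [] + 0#                          ∎
  totalFlagSum≈diagonalSum (suc n) x y g = begin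
    totalFlagSum x y g
      ≈⟨ totalFlagSum-peel ⟩
    (coeff true true false * totalFlagSum x′ y′ g[ true , true ]
      + coeff true false false * totalFlagSum x′ y′ g[ false , true ])
    + (coeff false false true * totalFlagSum x′ y′ g[ false , true ]
      + coeff false false false * totalFlagSum x′ y′ g[ false , false ])
      ≈⟨ cancel-middle coeff-cancel ⟩
    coeff true true false * totalFlagSum x′ y′ g[ true , true ]
      + coeff false false false * totalFlagSum x′ y′ g[ false , false ]
      ≈⟨ +-cong (*-cong coeff-in-B (totalFlagSum≈diagonalSum n x′ y′ g[ true , true ]))
                (*-cong coeff-empty (totalFlagSum≈diagonalSum n x′ y′ g[ false , false ])) ⟩
    (x₀ * y₀) * diagonalSum x′ y′ g[ true , true ] + 1# * diagonalSum x′ y′ g[ false , false ]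
      ≈⟨ diagonalSum-peel ⟨
    diagonalSum x y g ∎
    where open Peel x y g

-- The matroid enters only through the weight  g(B,U) = λ^{r - rk B} ξ^{r - rk U}:
-- both sides of the theorem are the two sides of the inversion identity for it.
module Expansion {c ℓ} (R : CommutativeRing c ℓ) {n : ℕ} (M : Matroid n) where
  open CommutativeRing R hiding (zero)
  open RingOps R
  open Identities R
  open Matroid M using (rk; isRank)
  open IsMatroidRank isRank using (rk-mono)
  open import Relation.Binary.Reasoning.Setoid setoid
  import Algebra.Solver.CommutativeMonoid *-commutativeMonoid as ×-Solver

  r : ℕ
  r = rankM M

  rankWeight : Carrier → Carrier → Subset n → Subset n → Carrier
  rankWeight l ξ B U = pow l (r ∸ rk B) * pow ξ (r ∸ rk U)

  module _ (x y : Fin n → Carrier) (l ξ : Carrier) where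
    SC≈diagonalSum : SC (asGR M) (λ e → x e * y e) (l * ξ) ≈ diagonalSum x y (rankWeight l ξ)
    SC≈diagonalSum = sum-cong (subsetsOf ⊤) (λ A → *-congˡ (pow-* l ξ (r ∸ rk A)))

    λ-telescope : ∀ {B T} → B ⊆ T → pow l (r ∸ rk T) * pow l (rk T ∸ rk B) ≈ pow l (r ∸ rk B)
    λ-telescope {B} {T} B⊆T =
      trans (pow-+ l (r ∸ rk T) (rk T ∸ rk B)) (reflexive (≡.cong (pow l) (∸-telescope (rk-mono B⊆T) (rk-mono ⊆⊤))))

    ξ-contract : ∀ C T → pow ξ ((r ∸ rk T) ∸ (rk (C ∪ T) ∸ rk T)) ≡ pow ξ (r ∸ rk (C ∪ T))
    ξ-contract C T = ≡.cong (pow ξ) (∸-∸-cancel r (rk-mono (q⊆p∪q C T)))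

    productTerm≈flagTerm : ∀ {T B} → B ⊆ T → ∀ C →
      (pow l (r ∸ rk T) * monomial (λ e → - y e) T * (monomial (λ e → - x e) B * pow l (rk T ∸ rk B)))
        * (monomial y C * pow ξ ((r ∸ rk T) ∸ (rk (C ∪ T) ∸ rk T)))
      ≈ flagTerm x y (rankWeight l ξ) T B C
    productTerm≈flagTerm {T} {B} B⊆T C = begin
      (pT * mT * (mB * lB)) * (mC * ξC)  ≈⟨ ×-Solver.solve 6
                                              (λ pT mT mB lB mC ξC → ((pT ⊕ mT) ⊕ (mB ⊕ lB)) ⊕ (mC ⊕ ξC)
                                                                   ⊜ ((mT ⊕ mB) ⊕ mC) ⊕ ((pT ⊕ lB) ⊕ ξC))
                                              refl pT mT mB lB mC ξC ⟩
      mT * mB * mC * ((pT * lB) * ξC)    ≈⟨ *-congˡ (*-cong (λ-telescope B⊆T) (reflexive (ξ-contract C T))) ⟩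
      flagTerm x y (rankWeight l ξ) T B C ∎
      where
      open ×-Solver using (_⊕_; _⊜_)
      pT lB ξC mT mB mC : Carrier
      pT = pow l (r ∸ rk T)
      lB = pow l (rk T ∸ rk B)
      ξC = pow ξ ((r ∸ rk T) ∸ (rk (C ∪ T) ∸ rk T))
      mT = monomial (λ e → - y e) T
      mB = monomial (λ e → - x e) B
      mC = monomial y C

    summand≈flagSum : ∀ T →
      pow l (r ∸ rk T) * monomial (λ e → - y e) T * SC (restrict M T) (λ e → - x e) l * SC (contract M T) y ξ
      ≈ flagSum x y (rankWeight l ξ) T
    summand≈flagSum T =
      trans (sum-product _ _ _ (subsetsOf T) (subsetsOf (∁ T)))
            (sum-cong-All (subsetsOf-⊆ T) (λ B B⊆T → sum-cong (subsetsOf (∁ T)) (productTerm≈flagTerm B⊆T)))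

mainTheorem1 : ∀ {c ℓ} (R : CommutativeRing c ℓ) (n : ℕ) (M : Matroid n) →
    let open CommutativeRing R
        open RingOps R
    in ∀ (x y : Fin n → Carrier) (l ξ : Carrier) →
       SC (asGR M) (λ e → x e * y e) (l * ξ)
       ≈ sumL (map (λ T → pow l (rankM M ∸ Matroid.rk M T)
                          * monomial (λ e → - y e) T
                          * SC (restrict M T) (λ e → - x e) l
                          * SC (contract M T) y ξ)
                   (subsetsOf ⊤))
mainTheorem1 R n M x y l ξ =
  trans (SC≈diagonalSum x y l ξ)
  (trans (sym (totalFlagSum≈diagonalSum n x y (rankWeight l ξ)))
         (sym (sum-cong (subsetsOf ⊤) (summand≈flagSum x y l ξ))))
  where
  open CommutativeRing R using (trans; sym)
  open Identities R using (totalFlagSum≈diagonalSum; sum-cong)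
  open Expansion R M
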